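{- For every QCL-formula $F$ and every interpretation $\mathcal{I}\subseteq\mathcal{U}$, the value of the game $\mathbf{NG}(\mathbf{P}:F,\mathcal{I})$ (defined in the context) is $\mathrm{deg}^G_\mathcal{I}(F)$.
   Context: QCL-formulas are built from propositional variables (from an infinite set $\mathcal{U}$) using $\neg$, $\wedge$, $\vee$ and the binary connective $\vec{\times}$. An interpretation is a set $\mathcal{I}\subseteq\mathcal{U}$. GCL-optionality: $\mathrm{opt}^G(a)=1$; $\mathrm{opt}^G(\neg F)=\mathrm{opt}^G(F)$; $\mathrm{opt}^G(F\circ G)=\max(\mathrm{opt}^G(F),\mathrm{opt}^G(G))$ for $\circ\in\{\wedge,\vee\}$; $\mathrm{opt}^G(F\vec{\times}G)=\mathrm{opt}^G(F)+\mathrm{opt}^G(G)$. Let $Z=\mathbb{Z}\setminus\{0\}$ with linear order $\trianglelefteq$: on $\mathbb{Z}^+$ and on $\mathbb{Z}^-$ it is the inverse of the natural order, and $b\triangleleft a$ for all $b\in\mathbb{Z}^-$, $a\in\mathbb{Z}^+$ (so $1$ is the top element). GCL-degree: $\mathrm{deg}^G_\mathcal{I}(a)=1$ if $a\in\mathcal{I}$, $-1$ otherwise; $\mathrm{deg}^G_\mathcal{I}(\neg F)=-\mathrm{deg}^G_\mathcal{I}(F)$; $\mathrm{deg}^G_\mathcal{I}(F\wedge G)=\min(\mathrm{deg}^G_\mathcal{I}(F),\mathrm{deg}^G_\mathcal{I}(G))$, $\mathrm{deg}^G_\mathcal{I}(F\vee G)=\max(\mathrm{deg}^G_\mathcal{I}(F),\mathrm{deg}^G_\mathcal{I}(G))$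 (w.r.t. $\trianglelefteq$); $\mathrm{deg}^G_\mathcal{I}(F\vec{\times}G)=\mathrm{deg}^G_\mathcal{I}(F)$ if $\mathrm{deg}^G_\mathcal{I}(F)\in\mathbb{Z}^+$; $=\mathrm{opt}^G(F)+\mathrm{deg}^G_\mathcal{I}(G)$ if $\mathrm{deg}^G_\mathcal{I}(F)\in\mathbb{Z}^-$ and $\mathrm{deg}^G_\mathcal{I}(G)\in\mathbb{Z}^+$; $=\mathrm{deg}^G_\mathcal{I}(F)-\mathrm{opt}^G(G)$ otherwise. The game $\mathbf{NG}(\mathbf{P}:F,\mathcal{I})$ is played between Me and You. Game trees: nodes are game states $\mathbf{Q}:H$ with $\mathbf{Q}\in\{\mathbf{P},\mathbf{O}\}$ (Me as proponent resp. opponent); $\bar{\mathbf{P}}=\mathbf{O}$, $\bar{\mathbf{O}}=\mathbf{P}$. $T(\mathbf{Q}:a)$ is a single leaf $\mathbf{Q}:a$; $T(\mathbf{Q}:\neg G)$ has root $\mathbf{Q}:\neg G$ with single immediate subtree $T(\bar{\mathbf{Q}}:G)$; for $\circ\in\{\wedge,\vee,\vec{\times}\}$, $T(\mathbf{Q}:G_1\circ G_2)$ has root $\mathbf{Q}:G_1\circ G_2$ with immediate subtrees $T(\mathbf{Q}:G_1)$, $T(\mathbf{Q}:G_2)$. At $\mathbf{P}:G_1\wedge G_2$ You choose the successor; at $\mathbf{P}:G_1\vee G_2$ and $\mathbf{P}:G_1\vec{\times}G_2$ I choose; at $\mathbf{O}:G_1\wedge G_2$ I choose; at $\mathbf{O}:G_1\vee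 G_2$ and $\mathbf{O}:G_1\vec{\times}G_2$ You choose. Leaves are outcomes; $\mathcal{O}(\mathbf{Q}:H)$ denotes the leaves of $T(\mathbf{Q}:H)$. Preference relations: $\ll_{\mathbf{P}:a}=\emptyset$; $\ll_{\mathbf{P}:\neg G}=\ll_{\mathbf{O}:G}$; $\ll_{\mathbf{P}:G_1\wedge G_2}=\ll_{\mathbf{P}:G_1\vee G_2}=\ll_{\mathbf{P}:G_1}\cup\ll_{\mathbf{P}:G_2}$; $O_1\ll_{\mathbf{P}:G_1\vec{\times}G_2}O_2$ iff ($O_1\in\mathcal{O}(\mathbf{P}:G_2)$ and $O_2\in\mathcal{O}(\mathbf{P}:G_1)$) or $O_1\ll_{\mathbf{P}:G_j}O_2$ for some $j$; and $\ll_{\mathbf{O}:H}$ is the inverse of $\ll_{\mathbf{P}:H}$ for every $H$. Let $\ll=\ll_{\mathbf{P}:F}$ and $\gg$ its inverse. A leaf $\mathbf{P}:a$ is true iff $a\in\mathcal{I}$; a leaf $\mathbf{O}:a$ is true iff $a\notin\mathcal{I}$; otherwise false. For an outcome $O$, $|\pi_\ll(O)|$ is the maximal $n$ such that there are pairwise distinct outcomes $O=O_1,\dots,O_n$ with $O_i\ll O_{i+1}$ for all $i<n$, and $|\pi_\gg(O)|$ is defined likewise with $\gg$. Payoff: $\delta(O)=|\pi_\ll(O)|$ if $O$ is true and $\delta(O)=-|\pi_\gg(O)|$ if $O$ is false, valued in $(Z,\trianglelefteq)$ (Me wants $\trianglelefteq$-large, You $\trianglelefteq$-small payoff). A strategy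 for Me is a set $\sigma$ of nodes containing the root such that for every $v\in\sigma$: if I choose at $v$ then at least one successor of $v$ is in $\sigma$, otherwise all successors of $v$ are in $\sigma$; strategies for You are symmetric. Each pair $(\sigma_I,\sigma_Y)$ determines a unique outcome with payoff $\delta(\sigma_I,\sigma_Y)$. The value of the game is $\max^{\trianglelefteq}_{\sigma_I}\min^{\trianglelefteq}_{\sigma_Y}\delta(\sigma_I,\sigma_Y)$. -}

module Defs where

open import Data.Nat as ℕ using (ℕ; zero; suc; _≤ᵇ_)
open import Data.Integer as ℤ using (ℤ; +_; -[1+_]; _-_)
open import Data.Bool using (Bool; true; false; if_then_else_; not)
open import Data.Product using (Σ; ∃; _×_; _,_)
open import Data.Sum using (_⊎_; inj₁; inj₂)
open import Data.Unit using (⊤; tt)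
open import Data.Empty using (⊥)
open import Data.List using (List; []; _∷_; length)
open import Data.List.Relation.Unary.Linked using (Linked)
open import Data.List.Relation.Unary.Unique.Propositional using (Unique)
open import Relation.Binary.PropositionalEquality using (_≡_)

data Conn : Set where
  and or ot : Conn          -- ∧, ∨, ordered disjunction ×⃗

data Form : Set where
  var : ℕ → Form
  neg : Form → Form
  bin : Conn → Form → Form → Form

-- Interpretation 𝓘 ⊆ 𝒰, given by its characteristic function
Interp : Set
Interp = ℕ → Bool

max : ℕ → ℕ → ℕ
max = ℕ._⊔_

opt : Form → ℕ
opt (var a) = 1
opt (neg F) = opt F
opt (bin and F G) = max (opt F) (opt G)
opt (bin or  F G) = max (opt F) (opt G)
opt (bin ot  F G) = opt F ℕ.+ opt G

-- the order ⊴ on Z = ℤ ∖ {0} (only meaningful on nonzero integers)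
leqᵇ : ℤ → ℤ → Bool
leqᵇ (+ suc m) (+ suc n) = n ≤ᵇ m
leqᵇ -[1+ m ] (+ suc n) = true
leqᵇ (+ suc m) -[1+ n ] = false
leqᵇ -[1+ m ] -[1+ n ] = m ≤ᵇ n
leqᵇ _ _ = false   -- cases involving 0, which is not an element of Z

infix 4 _⊴_
data _⊴_ : ℤ → ℤ → Set where
  neg-pos : ∀ m n → -[1+ m ] ⊴ + suc n
  pos-pos : ∀ {m n} → n ℕ.≤ m → + suc m ⊴ + suc n
  neg-neg : ∀ {m n} → m ℕ.≤ n → -[1+ m ] ⊴ -[1+ n ]

min⊴ max⊴ : ℤ → ℤ → ℤ
min⊴ d e = if leqᵇ d e then d else e
max⊴ d e = if leqᵇ d e then e else d

isPos : ℤ → Bool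
isPos (+ suc _) = true
isPos _ = false

deg : Interp → Form → ℤ
deg I (var a) = if I a then + 1 else -[1+ 0 ]
deg I (neg F) = ℤ.- deg I F
deg I (bin and F G) = min⊴ (deg I F) (deg I G)
deg I (bin or  F G) = max⊴ (deg I F) (deg I G)
deg I (bin ot  F G) with isPos (deg I F) | isPos (deg I G)
... | true  | _     = deg I F
... | false | true  = + opt F ℤ.+ deg I G
... | false | false = deg I F - + opt G

data Pol : Set where
  𝐏 𝐎 : Pol

flipP : Pol → Pol
flipP 𝐏 = 𝐎
flipP 𝐎 = 𝐏

data Player : Set where
  Me You : Player

-- who chooses the successor at a game state Q : G₁ ∘ G₂
chooser : Pol → Conn → Player
chooser 𝐏 and = You
chooser 𝐏 or  = Me
chooser 𝐏 ot  = Me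
chooser 𝐎 and = Me
chooser 𝐎 or  = You
chooser 𝐎 ot  = You

-- strategy node: if the player chooses, it keeps exactly one successor,
-- otherwise it must keep both
node : Player → Player → Set → Set → Set
node Me  Me  A B = A ⊎ B
node You You A B = A ⊎ B
node Me  You A B = A × B
node You Me  A B = A × B

Strat : Player → Pol → Form → Set
Strat p Q (var a) = ⊤
Strat p Q (neg F) = Strat p (flipP Q) F
Strat p Q (bin c F G) = node (chooser Q c) p (Strat p Q F) (Strat p Q G)

-- positions of the leaves (outcomes) of T(Q : F)  (independent of Q)
Leaf : Form → Set
Leaf (var a) = ⊤
Leaf (neg F) = Leaf F
Leaf (bin c F G) = Leaf F ⊎ Leaf G

label : Pol → (F : Form) → Leaf F → Pol × ℕ
label Q (var a) tt = Q , a
label Q (neg F) o = label (flipP Q) F o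
label Q (bin c F G) (inj₁ o) = label Q F o
label Q (bin c F G) (inj₂ o) = label Q G o

play : (Q : Pol) (F : Form) → Strat Me Q F → Strat You Q F → Leaf F
play Q (var a) _ _ = tt
play Q (neg F) s t = play (flipP Q) F s t
play Q (bin c F G) s t = go (chooser Q c) s t
  where
  go : (ch : Player) → node ch Me (Strat Me Q F) (Strat Me Q G) →
       node ch You (Strat You Q F) (Strat You Q G) → Leaf F ⊎ Leaf G
  go Me  (inj₁ s₁) (t₁ , t₂) = inj₁ (play Q F s₁ t₁)
  go Me  (inj₂ s₂) (t₁ , t₂) = inj₂ (play Q G s₂ t₂)
  go You (s₁ , s₂) (inj₁ t₁) = inj₁ (play Q F s₁ t₁)
  go You (s₁ , s₂) (inj₂ t₂) = inj₂ (play Q G s₂ t₂)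

-- the preference relation ≪_{P:F} on the outcomes of T(P : F);
-- ≪_{O:F} is its inverse, so ≪_{P:¬G} = ≪_{O:G} = inverse of ≪_{P:G}
Pref : (F : Form) → Leaf F → Leaf F → Set
Pref (var a) _ _ = ⊥
Pref (neg F) x y = Pref F y x
Pref (bin ot F G) (inj₂ x) (inj₁ y) = ⊤
Pref (bin c F G) (inj₁ x) (inj₁ y) = Pref F x y
Pref (bin c F G) (inj₂ x) (inj₂ y) = Pref G x y
Pref (bin c F G) _ _ = ⊥

Inv : {A : Set} → (A → A → Set) → A → A → Set
Inv R x y = R y x

Chain : {A : Set} → (A → A → Set) → A → ℕ → Set
Chain {A} R O n = Σ (List A) λ os →
  Σ (List A) (λ rest → os ≡ O ∷ rest) × length os ≡ n × Unique os × Linked R os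

-- |π_R(O)| = n : n is the maximal length of such a chain
MaxChain : {A : Set} → (A → A → Set) → A → ℕ → Set
MaxChain R O n = Chain R O n × (∀ m → Chain R O m → m ℕ.≤ n)

leafTrue : Interp → (F : Form) → Leaf F → Bool
leafTrue I F o with label 𝐏 F o
... | 𝐏 , a = I a
... | 𝐎 , a = not (I a)

PayoffB : Bool → (F : Form) → Leaf F → ℤ → Set
PayoffB true  F o d = ∃ λ n → MaxChain (Pref F) o n × d ≡ + n
PayoffB false F o d = ∃ λ n → MaxChain (Inv (Pref F)) o n × d ≡ ℤ.- (+ n)

Payoff : Interp → (F : Form) → Leaf F → ℤ → Set
Payoff I F o d = PayoffB (leafTrue I F o) F o d

-- the value of NG(P:F, 𝓘) is v, i.e. max_{σ_I} min_{σ_Y} δ(σ_I, σ_Y) = v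
-- (all strategy sets are finite and nonempty, so max/min exist):
-- some σ_I guarantees at least v, and every σ_I can be held to at most v
IsValue : Interp → Form → ℤ → Set
IsValue I F v =
  (Σ (Strat Me 𝐏 F) λ σI → (σY : Strat You 𝐏 F) →
     ∃ λ d → Payoff I F (play 𝐏 F σI σY) d × v ⊴ d)
  × ((σI : Strat Me 𝐏 F) → Σ (Strat You 𝐏 F) λ σY →
     ∃ λ d → Payoff I F (play 𝐏 F σI σY) d × d ⊴ v)

{-# OPTIONS --safe #-}
module Submission where

-- Every leaf o has a height (the number of steps of a longest ≪-chain starting at o)
-- and a depth (the same for ≫), both computable by recursion on the formula: ≪ is
-- the disjoint union of the relations of the immediate subformulas, except that at
-- G₁ ×⃗ G₂ every outcome of G₂ lies below every outcome of G₁, which adds opt G₁ to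
-- the heights of G₂ and opt G₂ to the depths of G₁.  So δ(o) is height + 1 or
-- −(depth + 1) according to the truth of o.  Inside the subgame at
-- Q : G the payoffs are those of G transformed by a map f that is monotone for
-- Q = 𝐏 and antitone for Q = 𝐎: negation changes sign, and the two sides of
-- G₁ ×⃗ G₂ shift the negative resp. positive values by opt G₂ resp. opt G₁.  Each
-- choice node is then a ⊴-maximum or minimum mirroring the clauses of deg; for ×⃗
-- this uses 1 ≤ |deg G| ≤ opt G.

open import Defs
open import Data.Bool using (Bool; true; false; not; if_then_else_)
open import Data.Bool.Properties using (not-involutive)
open import Data.Integer as ℤ using (ℤ; +_; -[1+_]; _-_)
open import Data.List using (List; []; _∷_; length; map; _++_)
open import Data.List.Properties using (length-map; length-++)
open import Data.List.Relation.Unary.AllPairs as AllPairs using ()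
open import Data.List.Relation.Unary.Linked as Linked using (Linked; []; [-]; _∷_)
open import Data.List.Relation.Unary.Linked.Properties using (Linked⇒AllPairs; map⁺)
open import Data.List.Relation.Unary.Unique.Propositional using (Unique)
open import Data.Nat using (ℕ; zero; suc; _≤ᵇ_; _≤_; _<_; _+_; _⊔_; s≤s; z≤n)
open import Data.Nat.Properties
open import Data.Product using (Σ; _×_; _,_; proj₁; map₁)
open import Data.Sum using (_⊎_; inj₁; inj₂)
open import Data.Unit using (⊤; tt)
open import Function using (_∘_; _on_; flip)
open import Relation.Binary.Core using (_Preserves_⟶_)
open import Relation.Binary.PropositionalEquality
open import Relation.Nullary.Reflects using (ofʸ; ofⁿ)

⊴-trans : ∀ {x y z} → x ⊴ y → y ⊴ z → x ⊴ z
⊴-trans (neg-pos m n) (pos-pos q) = neg-pos m _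
⊴-trans (pos-pos p) (pos-pos q) = pos-pos (≤-trans q p)
⊴-trans (neg-neg p) (neg-pos m n) = neg-pos _ n
⊴-trans (neg-neg p) (neg-neg q) = neg-neg (≤-trans p q)

neg-mono-⊴ : ∀ {x y} → x ⊴ y → ℤ.- y ⊴ ℤ.- x
neg-mono-⊴ (neg-pos m n) = neg-pos n m
neg-mono-⊴ (pos-pos p) = neg-neg p
neg-mono-⊴ (neg-neg p) = pos-pos p

data Bounded (a : ℕ) : ℤ → Set where
  bounded⁺ : ∀ {j} → j < a → Bounded a (+ suc j)
  bounded⁻ : ∀ {j} → j < a → Bounded a -[1+ j ]

⊴-refl : ∀ {a d} → Bounded a d → d ⊴ d
⊴-refl (bounded⁺ _) = pos-pos ≤-refl
⊴-refl (bounded⁻ _) = neg-neg ≤-refl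

Bounded-mono : ∀ {a b d} → a ≤ b → Bounded a d → Bounded b d
Bounded-mono a≤b (bounded⁺ j<a) = bounded⁺ (≤-trans j<a a≤b)
Bounded-mono a≤b (bounded⁻ j<a) = bounded⁻ (≤-trans j<a a≤b)

neg-Bounded : ∀ {a d} → Bounded a d → Bounded a (ℤ.- d)
neg-Bounded (bounded⁺ j<a) = bounded⁻ j<a
neg-Bounded (bounded⁻ j<a) = bounded⁺ j<a

leqᵇ-⊴ : ∀ {a b d e} → Bounded a d → Bounded b e →
  (leqᵇ d e ≡ true × d ⊴ e) ⊎ (leqᵇ d e ≡ false × e ⊴ d)
leqᵇ-⊴ (bounded⁺ {m} _) (bounded⁺ {n} _) with n ≤ᵇ m | ≤ᵇ-reflects-≤ n m
... | true  | ofʸ n≤m = inj₁ (refl , pos-pos n≤m)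
... | false | ofⁿ n≰m = inj₂ (refl , pos-pos (≰⇒≥ n≰m))
leqᵇ-⊴ (bounded⁺ {m} _) (bounded⁻ {n} _) = inj₂ (refl , neg-pos n m)
leqᵇ-⊴ (bounded⁻ {m} _) (bounded⁺ {n} _) = inj₁ (refl , neg-pos m n)
leqᵇ-⊴ (bounded⁻ {m} _) (bounded⁻ {n} _) with m ≤ᵇ n | ≤ᵇ-reflects-≤ m n
... | true  | ofʸ m≤n = inj₁ (refl , neg-neg m≤n)
... | false | ofⁿ m≰n = inj₂ (refl , neg-neg (≰⇒≥ m≰n))

record IsMax (_≼_ : ℤ → ℤ → Set) (x y m : ℤ) : Set where
  constructor isMax
  field
    x≼m : x ≼ m
    y≼m : y ≼ m
    attained : m ≼ x ⊎ m ≼ y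

IsMax-preserved : ∀ {R S : ℤ → ℤ → Set} {f : ℤ → ℤ} {x y m} →
  f Preserves R ⟶ S → IsMax R x y m → IsMax S (f x) (f y) (f m)
IsMax-preserved f-mono (isMax x≼m y≼m (inj₁ m≼x)) =
  isMax (f-mono x≼m) (f-mono y≼m) (inj₁ (f-mono m≼x))
IsMax-preserved f-mono (isMax x≼m y≼m (inj₂ m≼y)) =
  isMax (f-mono x≼m) (f-mono y≼m) (inj₂ (f-mono m≼y))

max⊴-isMax : ∀ {a b d e} → Bounded a d → Bounded b e → IsMax _⊴_ d e (max⊴ d e)
max⊴-isMax bd be with leqᵇ-⊴ bd be
... | inj₁ (eq , d⊴e) rewrite eq = isMax d⊴e (⊴-refl be) (inj₂ (⊴-refl be))
... | inj₂ (eq , e⊴d) rewrite eq = isMax (⊴-refl bd) e⊴d (inj₁ (⊴-refl bd))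

min⊴-isMin : ∀ {a b d e} → Bounded a d → Bounded b e → IsMax (flip _⊴_) d e (min⊴ d e)
min⊴-isMin bd be with leqᵇ-⊴ bd be
... | inj₁ (eq , d⊴e) rewrite eq = isMax (⊴-refl bd) d⊴e (inj₁ (⊴-refl bd))
... | inj₂ (eq , e⊴d) rewrite eq = isMax e⊴d (⊴-refl be) (inj₂ (⊴-refl be))

Bounded-max⊴ : ∀ {a b d e} → Bounded a d → Bounded b e → Bounded (a ⊔ b) (max⊴ d e)
Bounded-max⊴ {a} {b} bd be with leqᵇ-⊴ bd be
... | inj₁ (eq , _) rewrite eq = Bounded-mono (m≤n⊔m a b) be
... | inj₂ (eq , _) rewrite eq = Bounded-mono (m≤m⊔n a b) bd

Bounded-min⊴ : ∀ {a b d e} → Bounded a d → Bounded b e → Bounded (a ⊔ b) (min⊴ d e)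
Bounded-min⊴ {a} {b} bd be with leqᵇ-⊴ bd be
... | inj₁ (eq , _) rewrite eq = Bounded-mono (m≤m⊔n a b) bd
... | inj₂ (eq , _) rewrite eq = Bounded-mono (m≤n⊔m a b) be

shift⁻ : ℕ → ℤ → ℤ
shift⁻ b (+ n) = + n
shift⁻ b -[1+ k ] = -[1+ k + b ]

shift⁺ : ℕ → ℤ → ℤ
shift⁺ a (+ zero) = + zero
shift⁺ a (+ suc k) = + suc (k + a)
shift⁺ a -[1+ k ] = -[1+ k ]

shift⁻-mono-⊴ : ∀ b → shift⁻ b Preserves _⊴_ ⟶ _⊴_
shift⁻-mono-⊴ b (neg-pos m n) = neg-pos _ n
shift⁻-mono-⊴ b (pos-pos p) = pos-pos p
shift⁻-mono-⊴ b (neg-neg p) = neg-neg (+-monoˡ-≤ b p)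

shift⁺-mono-⊴ : ∀ a → shift⁺ a Preserves _⊴_ ⟶ _⊴_
shift⁺-mono-⊴ a (neg-pos m n) = neg-pos m _
shift⁺-mono-⊴ a (pos-pos p) = pos-pos (+-monoˡ-≤ a p)
shift⁺-mono-⊴ a (neg-neg p) = neg-neg p

otDegree : ℕ → ℕ → ℤ → ℤ → ℤ
otDegree a b d e with isPos d | isPos e
... | true  | _     = d
... | false | true  = + a ℤ.+ e
... | false | false = d - + b

-[1+m]-n≡-[1+m+n] : ∀ m n → -[1+ m ] - + n ≡ -[1+ m + n ]
-[1+m]-n≡-[1+m+n] m zero = cong -[1+_] (sym (+-identityʳ m))
-[1+m]-n≡-[1+m+n] m (suc n) = cong -[1+_] (sym (+-suc m n))

otDegree-isMax : ∀ {a b d e} → Bounded a d → Bounded b e →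
  IsMax _⊴_ (shift⁻ b d) (shift⁺ a e) (otDegree a b d e)
otDegree-isMax {a} (bounded⁺ j<a) (bounded⁺ {k} _) =
  isMax (⊴-refl (bounded⁺ j<a)) (pos-pos (≤-trans (<⇒≤ j<a) (m≤n+m a k)))
    (inj₁ (⊴-refl (bounded⁺ j<a)))
otDegree-isMax (bounded⁺ {j} j<a) (bounded⁻ {k} _) =
  isMax (⊴-refl (bounded⁺ j<a)) (neg-pos k j) (inj₁ (⊴-refl (bounded⁺ j<a)))
otDegree-isMax {a} (bounded⁻ _) (bounded⁺ {k} _) rewrite +-suc a k | +-comm a k =
  isMax (neg-pos _ _) (pos-pos ≤-refl) (inj₂ (pos-pos ≤-refl))
otDegree-isMax {b = b} (bounded⁻ {j} _) (bounded⁻ {k} k<b) rewrite -[1+m]-n≡-[1+m+n] j b =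
  isMax (neg-neg ≤-refl) (neg-neg (≤-trans (<⇒≤ k<b) (m≤n+m b j))) (inj₁ (neg-neg ≤-refl))

Bounded-otDegree : ∀ {a b d e} → Bounded a d → Bounded b e → Bounded (a + b) (otDegree a b d e)
Bounded-otDegree {a} {b} (bounded⁺ j<a) _ = bounded⁺ (≤-trans j<a (m≤m+n a b))
Bounded-otDegree {a} (bounded⁻ _) (bounded⁺ {k} k<b) rewrite +-suc a k = bounded⁺ (+-monoʳ-< a k<b)
Bounded-otDegree {b = b} (bounded⁻ {j} j<a) (bounded⁻ _) rewrite -[1+m]-n≡-[1+m+n] j b =
  bounded⁻ (+-monoˡ-< b j<a)

module _ (I : Interp) where

  deg-ot : ∀ F G → deg I (bin ot F G) ≡ otDegree (opt F) (opt G) (deg I F) (deg I G)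
  deg-ot F G with isPos (deg I F) | isPos (deg I G)
  ... | true  | true  = refl
  ... | true  | false = refl
  ... | false | true  = refl
  ... | false | false = refl

  deg-Bounded : ∀ F → Bounded (opt F) (deg I F)
  deg-Bounded (var a) with I a
  ... | true  = bounded⁺ (s≤s z≤n)
  ... | false = bounded⁻ (s≤s z≤n)
  deg-Bounded (neg F) = neg-Bounded (deg-Bounded F)
  deg-Bounded (bin and F G) = Bounded-min⊴ (deg-Bounded F) (deg-Bounded G)
  deg-Bounded (bin or F G) = Bounded-max⊴ (deg-Bounded F) (deg-Bounded G)
  deg-Bounded (bin ot F G) rewrite deg-ot F G = Bounded-otDegree (deg-Bounded F) (deg-Bounded G)

  deg-ot-isMax : ∀ F G →
    IsMax _⊴_ (shift⁻ (opt G) (deg I F)) (shift⁺ (opt F) (deg I G)) (deg I (bin ot F G))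
  deg-ot-isMax F G rewrite deg-ot F G = otDegree-isMax (deg-Bounded F) (deg-Bounded G)

height depth : (F : Form) → Leaf F → ℕ
height (var a) _ = 0
height (neg F) o = depth F o
height (bin and F G) (inj₁ o) = height F o
height (bin and F G) (inj₂ o) = height G o
height (bin or F G) (inj₁ o) = height F o
height (bin or F G) (inj₂ o) = height G o
height (bin ot F G) (inj₁ o) = height F o
height (bin ot F G) (inj₂ o) = height G o + opt F
depth (var a) _ = 0
depth (neg F) o = height F o
depth (bin and F G) (inj₁ o) = depth F o
depth (bin and F G) (inj₂ o) = depth G o
depth (bin or F G) (inj₁ o) = depth F o
depth (bin or F G) (inj₂ o) = depth G o
depth (bin ot F G) (inj₁ o) = depth F o + opt G
depth (bin ot F G) (inj₂ o) = depth G o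

height<opt : ∀ F o → height F o < opt F
depth<opt : ∀ F o → depth F o < opt F
height<opt (var a) o = s≤s z≤n
height<opt (neg F) o = depth<opt F o
height<opt (bin and F G) (inj₁ o) = ≤-trans (height<opt F o) (m≤m⊔n _ _)
height<opt (bin and F G) (inj₂ o) = ≤-trans (height<opt G o) (m≤n⊔m _ _)
height<opt (bin or F G) (inj₁ o) = ≤-trans (height<opt F o) (m≤m⊔n _ _)
height<opt (bin or F G) (inj₂ o) = ≤-trans (height<opt G o) (m≤n⊔m _ _)
height<opt (bin ot F G) (inj₁ o) = ≤-trans (height<opt F o) (m≤m+n _ _)
height<opt (bin ot F G) (inj₂ o) =
  subst (height G o + opt F <_) (+-comm (opt G) (opt F)) (+-monoˡ-< (opt F) (height<opt G o))
depth<opt (var a) o = s≤s z≤n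
depth<opt (neg F) o = height<opt F o
depth<opt (bin and F G) (inj₁ o) = ≤-trans (depth<opt F o) (m≤m⊔n _ _)
depth<opt (bin and F G) (inj₂ o) = ≤-trans (depth<opt G o) (m≤n⊔m _ _)
depth<opt (bin or F G) (inj₁ o) = ≤-trans (depth<opt F o) (m≤m⊔n _ _)
depth<opt (bin or F G) (inj₂ o) = ≤-trans (depth<opt G o) (m≤n⊔m _ _)
depth<opt (bin ot F G) (inj₁ o) = +-monoˡ-< (opt G) (depth<opt F o)
depth<opt (bin ot F G) (inj₂ o) = ≤-trans (depth<opt G o) (m≤n+m _ _)

Pref⇒height> : ∀ F {x y} → Pref F x y → height F y < height F x
Pref⇒depth< : ∀ F {x y} → Pref F x y → depth F x < depth F y
Pref⇒height> (neg F) x≪y = Pref⇒depth< F x≪y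
Pref⇒height> (bin and F G) {inj₁ _} {inj₁ _} x≪y = Pref⇒height> F x≪y
Pref⇒height> (bin and F G) {inj₂ _} {inj₂ _} x≪y = Pref⇒height> G x≪y
Pref⇒height> (bin or F G) {inj₁ _} {inj₁ _} x≪y = Pref⇒height> F x≪y
Pref⇒height> (bin or F G) {inj₂ _} {inj₂ _} x≪y = Pref⇒height> G x≪y
Pref⇒height> (bin ot F G) {inj₁ _} {inj₁ _} x≪y = Pref⇒height> F x≪y
Pref⇒height> (bin ot F G) {inj₂ _} {inj₂ _} x≪y = +-monoˡ-< (opt F) (Pref⇒height> G x≪y)
Pref⇒height> (bin ot F G) {inj₂ _} {inj₁ y} _ = ≤-trans (height<opt F y) (m≤n+m _ _)
Pref⇒depth< (neg F) x≪y = Pref⇒height> F x≪y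
Pref⇒depth< (bin and F G) {inj₁ _} {inj₁ _} x≪y = Pref⇒depth< F x≪y
Pref⇒depth< (bin and F G) {inj₂ _} {inj₂ _} x≪y = Pref⇒depth< G x≪y
Pref⇒depth< (bin or F G) {inj₁ _} {inj₁ _} x≪y = Pref⇒depth< F x≪y
Pref⇒depth< (bin or F G) {inj₂ _} {inj₂ _} x≪y = Pref⇒depth< G x≪y
Pref⇒depth< (bin ot F G) {inj₁ _} {inj₁ _} x≪y = +-monoˡ-< (opt G) (Pref⇒depth< F x≪y)
Pref⇒depth< (bin ot F G) {inj₂ _} {inj₂ _} x≪y = Pref⇒depth< G x≪y
Pref⇒depth< (bin ot F G) {inj₂ x} {inj₁ _} _ = ≤-trans (depth<opt G x) (m≤n+m _ _)

Path : {A : Set} → (A → A → Set) → ℕ → Set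
Path {A} R n = Σ (List A) λ xs → length xs ≡ n × Linked R xs

PathFrom : {A : Set} → (A → A → Set) → A → ℕ → Set
PathFrom {A} R x n = Σ (List A) λ xs → length xs ≡ n × Linked R (x ∷ xs)

module _ {C : Set} {R : C → C → Set} where

  Path-map : ∀ {A : Set} (f : A → C) {n} → Path (R on f) n → Path R n
  Path-map f (xs , len , linked) = map f xs , trans (length-map f xs) len , map⁺ linked

  PathFrom-map : ∀ {A : Set} (f : A → C) {x n} → PathFrom (R on f) x n → PathFrom R (f x) n
  PathFrom-map f (xs , len , linked) = map f xs , trans (length-map f xs) len , map⁺ linked

  module _ {A B : Set} (f : A → C) (g : B → C) where

    Path-⊔ : ∀ {m n} → Path (R on f) m → Path (R on g) n → Path R (m ⊔ n)
    Path-⊔ {m} {n} p q with ≤-total m n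
    ... | inj₁ m≤n = subst (Path R) (sym (m≤n⇒m⊔n≡n m≤n)) (Path-map g q)
    ... | inj₂ n≤m = subst (Path R) (sym (m≥n⇒m⊔n≡m n≤m)) (Path-map f p)

    module _ (f≺g : ∀ a b → R (f a) (g b)) where

      ++-linked : ∀ xs ys → Linked (R on f) xs → Linked (R on g) ys → Linked R (map f xs ++ map g ys)
      ++-linked [] ys _ linked = map⁺ linked
      ++-linked (x ∷ []) [] _ _ = [-]
      ++-linked (x ∷ []) (y ∷ ys) _ linked = f≺g x y ∷ map⁺ linked
      ++-linked (x ∷ x′ ∷ xs) ys (r ∷ linked) linked′ = r ∷ ++-linked (x′ ∷ xs) ys linked linked′

      length-++-map : ∀ xs ys → length (map f xs ++ map g ys) ≡ length xs + length ys
      length-++-map xs ys = trans (length-++ (map f xs)) (cong₂ _+_ (length-map f xs) (length-map g ys))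

      Path-++ : ∀ {m n} → Path (R on f) m → Path (R on g) n → Path R (m + n)
      Path-++ (xs , refl , lxs) (ys , refl , lys) =
        map f xs ++ map g ys , length-++-map xs ys , ++-linked xs ys lxs lys

      PathFrom-++ : ∀ {x m n} → PathFrom (R on f) x m → Path (R on g) n → PathFrom R (f x) (m + n)
      PathFrom-++ {x} (xs , refl , lxs) (ys , refl , lys) =
        map f xs ++ map g ys , length-++-map xs ys , ++-linked (x ∷ xs) ys lxs lys

optPath≪ : ∀ F → Path (Pref F) (opt F)
optPath≫ : ∀ F → Path (Inv (Pref F)) (opt F)
optPath≪ (var a) = tt ∷ [] , refl , [-]
optPath≪ (neg F) = optPath≫ F
optPath≪ (bin and F G) = Path-⊔ inj₁ inj₂ (optPath≪ F) (optPath≪ G)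
optPath≪ (bin or F G) = Path-⊔ inj₁ inj₂ (optPath≪ F) (optPath≪ G)
optPath≪ (bin ot F G) =
  subst (Path _) (+-comm (opt G) (opt F)) (Path-++ inj₂ inj₁ (λ _ _ → tt) (optPath≪ G) (optPath≪ F))
optPath≫ (var a) = tt ∷ [] , refl , [-]
optPath≫ (neg F) = optPath≪ F
optPath≫ (bin and F G) = Path-⊔ inj₁ inj₂ (optPath≫ F) (optPath≫ G)
optPath≫ (bin or F G) = Path-⊔ inj₁ inj₂ (optPath≫ F) (optPath≫ G)
optPath≫ (bin ot F G) = Path-++ inj₁ inj₂ (λ _ _ → tt) (optPath≫ F) (optPath≫ G)

heightPath : ∀ F o → PathFrom (Pref F) o (height F o)
depthPath : ∀ F o → PathFrom (Inv (Pref F)) o (depth F o)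
heightPath (var a) o = [] , refl , [-]
heightPath (neg F) o = depthPath F o
heightPath (bin and F G) (inj₁ o) = PathFrom-map inj₁ (heightPath F o)
heightPath (bin and F G) (inj₂ o) = PathFrom-map inj₂ (heightPath G o)
heightPath (bin or F G) (inj₁ o) = PathFrom-map inj₁ (heightPath F o)
heightPath (bin or F G) (inj₂ o) = PathFrom-map inj₂ (heightPath G o)
heightPath (bin ot F G) (inj₁ o) = PathFrom-map inj₁ (heightPath F o)
heightPath (bin ot F G) (inj₂ o) = PathFrom-++ inj₂ inj₁ (λ _ _ → tt) (heightPath G o) (optPath≪ F)
depthPath (var a) o = [] , refl , [-]
depthPath (neg F) o = heightPath F o
depthPath (bin and F G) (inj₁ o) = PathFrom-map inj₁ (depthPath F o)
depthPath (bin and F G) (inj₂ o) = PathFrom-map inj₂ (depthPath G o)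
depthPath (bin or F G) (inj₁ o) = PathFrom-map inj₁ (depthPath F o)
depthPath (bin or F G) (inj₂ o) = PathFrom-map inj₂ (depthPath G o)
depthPath (bin ot F G) (inj₁ o) = PathFrom-++ inj₁ inj₂ (λ _ _ → tt) (depthPath F o) (optPath≫ G)
depthPath (bin ot F G) (inj₂ o) = PathFrom-map inj₂ (depthPath G o)

module _ {A : Set} {R : A → A → Set} (μ : A → ℕ) (μ-decreasing : ∀ {x y} → R x y → μ y < μ x) where

  length≤1+μ : ∀ {x xs} → Linked R (x ∷ xs) → length (x ∷ xs) ≤ suc (μ x)
  length≤1+μ [-] = s≤s z≤n
  length≤1+μ (r ∷ linked) = s≤s (≤-trans (length≤1+μ linked) (μ-decreasing r))

  Linked⇒Unique : ∀ {xs} → Linked R xs → Unique xs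
  Linked⇒Unique linked =
    AllPairs.map (λ μy<μx x≡y → <-irrefl (cong μ (sym x≡y)) μy<μx)
      (Linked⇒AllPairs (λ μy<μx μz<μy → <-trans μz<μy μy<μx)
        (Linked.map {S = λ x y → μ y < μ x} μ-decreasing linked))

  PathFrom⇒MaxChain : ∀ {x} → PathFrom R x (μ x) → MaxChain R x (suc (μ x))
  PathFrom⇒MaxChain {x} (xs , len , linked) =
    (x ∷ xs , (xs , refl) , cong suc len , Linked⇒Unique linked , linked) ,
    λ { _ (_ , (_ , refl) , refl , _ , linked′) → length≤1+μ linked′ }

height-MaxChain : ∀ F o → MaxChain (Pref F) o (suc (height F o))
height-MaxChain F o = PathFrom⇒MaxChain (height F) (Pref⇒height> F) (heightPath F o)

depth-MaxChain : ∀ F o → MaxChain (Inv (Pref F)) o (suc (depth F o))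
depth-MaxChain F o = PathFrom⇒MaxChain (depth F) (Pref⇒depth< F) (depthPath F o)

label-flipP : ∀ Q F o → label (flipP Q) F o ≡ map₁ flipP (label Q F o)
label-flipP Q (var a) o = refl
label-flipP Q (neg F) o = label-flipP (flipP Q) F o
label-flipP Q (bin c F G) (inj₁ o) = label-flipP Q F o
label-flipP Q (bin c F G) (inj₂ o) = label-flipP Q G o

IsGameValue : (SI SY : Set) → (SI → SY → ℤ) → ℤ → Set
IsGameValue SI SY p v = (Σ SI λ s → ∀ t → v ⊴ p s t) × (∀ s → Σ SY λ t → p s t ⊴ v)

IsGameValue-cong : ∀ {SI SY p q v} → (∀ s t → p s t ≡ q s t) →
  IsGameValue SI SY p v → IsGameValue SI SY q v
IsGameValue-cong {v = v} p≗q ((s , v⊴p) , hold) =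
  (s , λ t → subst (v ⊴_) (p≗q s t) (v⊴p t)) ,
  λ s′ → let (t , p⊴v) = hold s′ in t , subst (_⊴ v) (p≗q s′ t) p⊴v

value-leaf : ∀ {x} → x ⊴ x → IsGameValue ⊤ ⊤ (λ _ _ → x) x
value-leaf x⊴x = (tt , λ _ → x⊴x) , λ _ → tt , x⊴x

value-meChooses : {A B A′ B′ : Set} {p₁ : A → A′ → ℤ} {p₂ : B → B′ → ℤ} {v₁ v₂ v : ℤ}
  (p : A ⊎ B → A′ × B′ → ℤ) →
  (∀ s t₁ t₂ → p (inj₁ s) (t₁ , t₂) ≡ p₁ s t₁) →
  (∀ s t₁ t₂ → p (inj₂ s) (t₁ , t₂) ≡ p₂ s t₂) →
  IsGameValue A A′ p₁ v₁ → IsGameValue B B′ p₂ v₂ → IsMax _⊴_ v₁ v₂ v →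
  IsGameValue (A ⊎ B) (A′ × B′) p v
value-meChooses {A} {B} {A′} {B′} {v₁ = v₁} {v₂} {v} p p≡p₁ p≡p₂
  ((s₁ , v₁⊴p₁) , hold₁) ((s₂ , v₂⊴p₂) , hold₂) (isMax v₁⊴v v₂⊴v attained) =
  guarantee attained , hold
  where
  guarantee : v ⊴ v₁ ⊎ v ⊴ v₂ → Σ (A ⊎ B) λ s → ∀ t → v ⊴ p s t
  guarantee (inj₁ v⊴v₁) =
    inj₁ s₁ , λ (t₁ , t₂) → subst (v ⊴_) (sym (p≡p₁ s₁ t₁ t₂)) (⊴-trans v⊴v₁ (v₁⊴p₁ t₁))
  guarantee (inj₂ v⊴v₂) =
    inj₂ s₂ , λ (t₁ , t₂) → subst (v ⊴_) (sym (p≡p₂ s₂ t₁ t₂)) (⊴-trans v⊴v₂ (v₂⊴p₂ t₂))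
  hold : ∀ s → Σ (A′ × B′) λ t → p s t ⊴ v
  hold (inj₁ s) = let (t₁ , p₁⊴v₁) = hold₁ s; t₂ = proj₁ (hold₂ s₂) in
    (t₁ , t₂) , subst (_⊴ v) (sym (p≡p₁ s t₁ t₂)) (⊴-trans p₁⊴v₁ v₁⊴v)
  hold (inj₂ s) = let (t₂ , p₂⊴v₂) = hold₂ s; t₁ = proj₁ (hold₁ s₁) in
    (t₁ , t₂) , subst (_⊴ v) (sym (p≡p₂ s t₁ t₂)) (⊴-trans p₂⊴v₂ v₂⊴v)

value-youChooses : {A B A′ B′ : Set} {p₁ : A → A′ → ℤ} {p₂ : B → B′ → ℤ} {v₁ v₂ v : ℤ}
  (p : A × B → A′ ⊎ B′ → ℤ) →
  (∀ s₁ s₂ t → p (s₁ , s₂) (inj₁ t) ≡ p₁ s₁ t) →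
  (∀ s₁ s₂ t → p (s₁ , s₂) (inj₂ t) ≡ p₂ s₂ t) →
  IsGameValue A A′ p₁ v₁ → IsGameValue B B′ p₂ v₂ → IsMax (flip _⊴_) v₁ v₂ v →
  IsGameValue (A × B) (A′ ⊎ B′) p v
value-youChooses {A} {B} {A′} {B′} {v₁ = v₁} {v₂} {v} p p≡p₁ p≡p₂
  ((s₁ , v₁⊴p₁) , hold₁) ((s₂ , v₂⊴p₂) , hold₂) (isMax v⊴v₁ v⊴v₂ attained) =
  guarantee , hold attained
  where
  guarantee : Σ (A × B) λ s → ∀ t → v ⊴ p s t
  guarantee = (s₁ , s₂) , λ
    { (inj₁ t) → subst (v ⊴_) (sym (p≡p₁ s₁ s₂ t)) (⊴-trans v⊴v₁ (v₁⊴p₁ t))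
    ; (inj₂ t) → subst (v ⊴_) (sym (p≡p₂ s₁ s₂ t)) (⊴-trans v⊴v₂ (v₂⊴p₂ t)) }
  hold : v₁ ⊴ v ⊎ v₂ ⊴ v → ∀ s → Σ (A′ ⊎ B′) λ t → p s t ⊴ v
  hold (inj₁ v₁⊴v) (s , s′) = let (t , p₁⊴v₁) = hold₁ s in
    inj₁ t , subst (_⊴ v) (sym (p≡p₁ s s′ t)) (⊴-trans p₁⊴v₁ v₁⊴v)
  hold (inj₂ v₂⊴v) (s′ , s) = let (t , p₂⊴v₂) = hold₂ s in
    inj₂ t , subst (_⊴ v) (sym (p≡p₂ s′ s t)) (⊴-trans p₂⊴v₂ v₂⊴v)

Oriented : Pol → ℤ → ℤ → Set
Oriented 𝐏 = _⊴_
Oriented 𝐎 = flip _⊴_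

Oriented-refl : ∀ Q {x} → Oriented Q x x → x ⊴ x
Oriented-refl 𝐏 x⊴x = x⊴x
Oriented-refl 𝐎 x⊴x = x⊴x

neg-Oriented : ∀ Q {f : ℤ → ℤ} → f Preserves _⊴_ ⟶ Oriented Q →
  (f ∘ ℤ.-_) Preserves _⊴_ ⟶ Oriented (flipP Q)
neg-Oriented 𝐏 f-mono x⊴y = f-mono (neg-mono-⊴ x⊴y)
neg-Oriented 𝐎 f-mono x⊴y = f-mono (neg-mono-⊴ x⊴y)

module _ (I : Interp) where

  isTrue : Pol × ℕ → Bool
  isTrue (𝐏 , a) = I a
  isTrue (𝐎 , a) = not (I a)

  leafTrue≡isTrue : ∀ F o → leafTrue I F o ≡ isTrue (label 𝐏 F o)
  leafTrue≡isTrue F o with label 𝐏 F o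
  ... | 𝐏 , a = refl
  ... | 𝐎 , a = refl

  isTrue-flipP : ∀ l → isTrue (map₁ flipP l) ≡ not (isTrue l)
  isTrue-flipP (𝐏 , a) = refl
  isTrue-flipP (𝐎 , a) = sym (not-involutive (I a))

  pay : (F : Form) → Leaf F → ℤ
  pay F o = if isTrue (label 𝐏 F o) then + suc (height F o) else -[1+ depth F o ]

  pay-Payoff : ∀ F o → Payoff I F o (pay F o)
  pay-Payoff F o rewrite leafTrue≡isTrue F o with isTrue (label 𝐏 F o)
  ... | true  = suc (height F o) , height-MaxChain F o , refl
  ... | false = suc (depth F o) , depth-MaxChain F o , refl

  pay-neg : ∀ F o → pay (neg F) o ≡ ℤ.- pay F o
  pay-neg F o rewrite label-flipP 𝐏 F o | isTrue-flipP (label 𝐏 F o) with isTrue (label 𝐏 F o)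
  ... | true  = refl
  ... | false = refl

  pay-ot₁ : ∀ F G o → pay (bin ot F G) (inj₁ o) ≡ shift⁻ (opt G) (pay F o)
  pay-ot₁ F G o with isTrue (label 𝐏 F o)
  ... | true  = refl
  ... | false = refl

  pay-ot₂ : ∀ F G o → pay (bin ot F G) (inj₂ o) ≡ shift⁺ (opt F) (pay G o)
  pay-ot₂ F G o with isTrue (label 𝐏 G o)
  ... | true  = refl
  ... | false = refl

  subgame-value : ∀ F Q {f : ℤ → ℤ} → f Preserves _⊴_ ⟶ Oriented Q →
    IsGameValue (Strat Me Q F) (Strat You Q F) (λ s t → f (pay F (play Q F s t))) (f (deg I F))
  subgame-value (var a) Q f-mono =
    value-leaf (Oriented-refl Q (f-mono (⊴-refl (deg-Bounded I (var a)))))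
  subgame-value (neg F) Q {f} f-mono =
    IsGameValue-cong (λ s t → cong f (sym (pay-neg F (play (flipP Q) F s t))))
      (subgame-value F (flipP Q) (neg-Oriented Q f-mono))
  subgame-value (bin and F G) 𝐏 f-mono =
    value-youChooses _ (λ _ _ _ → refl) (λ _ _ _ → refl)
      (subgame-value F 𝐏 f-mono) (subgame-value G 𝐏 f-mono)
      (IsMax-preserved f-mono (min⊴-isMin (deg-Bounded I F) (deg-Bounded I G)))
  subgame-value (bin and F G) 𝐎 f-mono =
    value-meChooses _ (λ _ _ _ → refl) (λ _ _ _ → refl)
      (subgame-value F 𝐎 f-mono) (subgame-value G 𝐎 f-mono)
      (IsMax-preserved f-mono (min⊴-isMin (deg-Bounded I F) (deg-Bounded I G)))
  subgame-value (bin or F G) 𝐏 f-mono =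
    value-meChooses _ (λ _ _ _ → refl) (λ _ _ _ → refl)
      (subgame-value F 𝐏 f-mono) (subgame-value G 𝐏 f-mono)
      (IsMax-preserved f-mono (max⊴-isMax (deg-Bounded I F) (deg-Bounded I G)))
  subgame-value (bin or F G) 𝐎 f-mono =
    value-youChooses _ (λ _ _ _ → refl) (λ _ _ _ → refl)
      (subgame-value F 𝐎 f-mono) (subgame-value G 𝐎 f-mono)
      (IsMax-preserved f-mono (max⊴-isMax (deg-Bounded I F) (deg-Bounded I G)))
  subgame-value (bin ot F G) 𝐏 {f} f-mono =
    value-meChooses _ (λ _ _ _ → cong f (pay-ot₁ F G _)) (λ _ _ _ → cong f (pay-ot₂ F G _))
      (subgame-value F 𝐏 (f-mono ∘ shift⁻-mono-⊴ (opt G)))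
      (subgame-value G 𝐏 (f-mono ∘ shift⁺-mono-⊴ (opt F)))
      (IsMax-preserved f-mono (deg-ot-isMax I F G))
  subgame-value (bin ot F G) 𝐎 {f} f-mono =
    value-youChooses _ (λ _ _ _ → cong f (pay-ot₁ F G _)) (λ _ _ _ → cong f (pay-ot₂ F G _))
      (subgame-value F 𝐎 (f-mono ∘ shift⁻-mono-⊴ (opt G)))
      (subgame-value G 𝐎 (f-mono ∘ shift⁺-mono-⊴ (opt F)))
      (IsMax-preserved f-mono (deg-ot-isMax I F G))

IsGameValue⇒IsValue : ∀ I F {v} →
  IsGameValue (Strat Me 𝐏 F) (Strat You 𝐏 F) (λ s t → pay I F (play 𝐏 F s t)) v → IsValue I F v
IsGameValue⇒IsValue I F ((σI , v⊴δ) , hold) =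
  (σI , λ σY → pay I F (play 𝐏 F σI σY) , pay-Payoff I F _ , v⊴δ σY) ,
  λ σI′ → let (σY , δ⊴v) = hold σI′ in σY , pay I F (play 𝐏 F σI′ σY) , pay-Payoff I F _ , δ⊴v

theorem2 : (F : Form) (I : Interp) → IsValue I F (deg I F)
theorem2 F I = IsGameValue⇒IsValue I F (subgame-value I F 𝐏 (λ d⊴e → d⊴e))
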